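{- Let $A$ be an $m\times n$ array with entries from $\{0,\dots,\sigma-1\}$, let $P$ be the set of all positions that are the answer $\mathsf{rmq}(1,i,1,j)$ for some $i\in[m]$, $j\in[n]$, and for each $\ell\in\{0,\dots,\sigma-1\}$ let $S_\ell=\{(i,j)\in P : A[i][j]=\ell\}$. Then for every $\ell$: (a) no position in $S_\ell$ is dominated by any other position of $S_\ell$; (b) the $k$-th bottom-most position of $S_\ell$ coincides with the $k$-th leftmost position of $S_\ell$; (c) the union of the 2-sided regions defined by the positions of $S_\ell$ contains no value smaller than $\ell$.
   Context: For a rectangle $[i_1,i_2]\times[j_1,j_2]$ (rows $i_1..i_2$, columns $j_1..j_2$), $\mathsf{rmq}(i_1,i_2,j_1,j_2)$ returns the position of a smallest element in the rectangle, ties broken by returning the top-leftmost such position. For a position $(i,j)$, its 2-sided region is $[1,i]\times[1,j]$. A position $(i',j')$ dominates $(i,j)$ iff $i\le i'$ and $j\le j'$. -}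

module Defs where

open import Data.Nat using (ℕ)
open import Data.Fin using (Fin; _≤_; _<_)
open import Data.Product using (_×_; Σ; ∃; ∃-syntax; proj₁; proj₂)
open import Data.List using (List; length)
open import Data.List.Membership.Propositional using (_∈_)
open import Data.List.Relation.Unary.Unique.Propositional using (Unique)
open import Relation.Binary.PropositionalEquality using (_≡_)
open import Function.Bundles using (_⇔_)

-- Positions are 0-indexed: row i : Fin m, column j : Fin n.
Pos : ℕ → ℕ → Set
Pos m n = Fin m × Fin n

row : ∀ {m n} → Pos m n → Fin m
row = proj₁

col : ∀ {m n} → Pos m n → Fin n
col = proj₂

Array : ℕ → ℕ → ℕ → Set
Array m n σ = Fin m → Fin n → Fin σ

_at_ : ∀ {m n σ} → Array m n σ → Pos m n → Fin σ
A at p = A (row p) (col p)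

InRect : ∀ {m n} → Fin m → Fin m → Fin n → Fin n → Pos m n → Set
InRect i₁ i₂ j₁ j₂ p = (i₁ ≤ row p × row p ≤ i₂) × (j₁ ≤ col p × col p ≤ j₂)

TopLeftOf : ∀ {m n} → Pos m n → Pos m n → Set
TopLeftOf p q = row p < row q ⊎' (row p ≡ row q × col p ≤ col q)
  where
  open import Data.Sum using () renaming (_⊎_ to _⊎'_)

IsRmq : ∀ {m n σ} → Array m n σ → Fin m → Fin m → Fin n → Fin n → Pos m n → Set
IsRmq A i₁ i₂ j₁ j₂ p =
  InRect i₁ i₂ j₁ j₂ p
  × (∀ q → InRect i₁ i₂ j₁ j₂ q → A at p ≤ A at q)
  × (∀ q → InRect i₁ i₂ j₁ j₂ q → A at q ≡ A at p → TopLeftOf p q)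

-- The set P: answers of rmq(1,i,1,j) (0-indexed: rows 0..i, columns 0..j).
InP : ∀ {m n σ} → Array m n σ → Pos m n → Set
InP {m} {n} A p = ∃[ i ] ∃[ j ] Σ (Fin m) λ z₁ → Σ (Fin n) λ z₂ →
  (Data.Fin.toℕ z₁ ≡ 0) × (Data.Fin.toℕ z₂ ≡ 0) × IsRmq A z₁ i z₂ j p
  where import Data.Fin

InS : ∀ {m n σ} → Array m n σ → Fin σ → Pos m n → Set
InS A ℓ p = InP A p × A at p ≡ ℓ

Dominates : ∀ {m n} → Pos m n → Pos m n → Set
Dominates q p = row p ≤ row q × col p ≤ col q

HasCard : ∀ {m n} → (Pos m n → Set) → ℕ → Set
HasCard {m} {n} Q k =
  Σ (List (Pos m n)) λ L → Unique L × (∀ q → (q ∈ L) ⇔ Q q) × length L ≡ k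

-- p is the k-th bottom-most position of S (k counted from 0):
-- p ∈ S and exactly k positions of S lie strictly below p.
KthBottom : ∀ {m n} → (Pos m n → Set) → ℕ → Pos m n → Set
KthBottom S k p = S p × HasCard (λ q → S q × row p < row q) k

-- p is the k-th leftmost position of S (k counted from 0):
-- p ∈ S and exactly k positions of S lie strictly left of p.
KthLeft : ∀ {m n} → (Pos m n → Set) → ℕ → Pos m n → Set
KthLeft S k p = S p × HasCard (λ q → S q × col q < col p) k

{-# OPTIONS --safe #-}
module Submission where

-- A position of P answers the rmq query of its own 2-sided region, as that region lies
-- inside the origin rectangle it answers. So if p, q ∈ S_ℓ and q dominates p, the tie
-- A[p] = A[q] in q's region forces q to be top-left of p, hence q = p; this gives (a),
-- and (c) is the minimality part. In an antichain, lying lower is the same as lying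
-- further left, so the sets counted by "k-th bottom-most" and "k-th leftmost" coincide.

open import Defs
open import Data.Nat using (ℕ; z≤n)
import Data.Nat.Properties as ℕ
open import Data.Fin using (Fin; _≤_; _<_; toℕ)
open import Data.Fin.Properties using (≤-trans; ≤-antisym; <⇒≢)
open import Data.Product using (_×_; _,_; proj₁; proj₂)
open import Data.Sum using (inj₁; inj₂)
open import Data.Empty using (⊥-elim)
open import Relation.Binary.PropositionalEquality using (_≡_; sym; trans; cong; cong₂; subst)
open import Relation.Nullary using (¬_)
open import Function.Bundles using (_⇔_; mk⇔)
open import Function.Properties.Equivalence using () renaming (sym to ⇔-sym; trans to ⇔-trans)

HasCard-cong : ∀ {m n} {Q R : Pos m n → Set} {k} →
  (∀ q → Q q ⇔ R q) → HasCard Q k → HasCard R k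
HasCard-cong Q⇔R (L , unique , ∈L⇔Q , length≡k) =
  L , unique , (λ q → ⇔-trans (∈L⇔Q q) (Q⇔R q)) , length≡k

Antichain : ∀ {m n} → (Pos m n → Set) → Set
Antichain {m} {n} S = (p q : Pos m n) → S p → S q → ¬ (p ≡ q) → ¬ Dominates q p

module _ {m n} {S : Pos m n → Set} (antichain : Antichain S) where

  below⇒left : ∀ {p q} → S p → S q → row p < row q → col q < col p
  below⇒left {p} {q} sp sq rp<rq = ℕ.≰⇒> λ cp≤cq →
    antichain p q sp sq (λ p≡q → <⇒≢ rp<rq (cong row p≡q)) (ℕ.<⇒≤ rp<rq , cp≤cq)

  left⇒below : ∀ {p q} → S p → S q → col q < col p → row p < row q
  left⇒below {p} {q} sp sq cq<cp = ℕ.≰⇒> λ rq≤rp →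
    antichain q p sq sp (λ q≡p → <⇒≢ cq<cp (cong col q≡p)) (rq≤rp , ℕ.<⇒≤ cq<cp)

  below⇔left : ∀ {p} → S p → ∀ q → (S q × row p < row q) ⇔ (S q × col q < col p)
  below⇔left sp q = mk⇔ (λ (sq , rp<rq) → sq , below⇒left sp sq rp<rq)
                        (λ (sq , cq<cp) → sq , left⇒below sp sq cq<cp)

  KthBottom⇔KthLeft : ∀ k p → KthBottom S k p ⇔ KthLeft S k p
  KthBottom⇔KthLeft k p = mk⇔
    (λ (sp , below) → sp , HasCard-cong (below⇔left sp) below)
    (λ (sp , left) → sp , HasCard-cong (λ q → ⇔-sym (below⇔left sp q)) left)

dominating-topLeftOf⇒≡ : ∀ {m n} {p q : Pos m n} → Dominates q p → TopLeftOf q p → q ≡ p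
dominating-topLeftOf⇒≡ (rp≤rq , _) (inj₁ rq<rp) = ⊥-elim (ℕ.<⇒≱ rq<rp rp≤rq)
dominating-topLeftOf⇒≡ (_ , cp≤cq) (inj₂ (rq≡rp , cq≤cp)) =
  cong₂ _,_ rq≡rp (≤-antisym cq≤cp cp≤cq)

toℕ≡0⇒≤ : ∀ {m} {i j : Fin m} → toℕ i ≡ 0 → i ≤ j
toℕ≡0⇒≤ i≡0 = ℕ.≤-trans (ℕ.≤-reflexive i≡0) z≤n

origin-rect-⊇-dominated : ∀ {m n} {i₁ i₂ : Fin m} {j₁ j₂ : Fin n} {p q : Pos m n} →
  toℕ i₁ ≡ 0 → toℕ j₁ ≡ 0 → InRect i₁ i₂ j₁ j₂ p → Dominates p q → InRect i₁ i₂ j₁ j₂ q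
origin-rect-⊇-dominated i₁≡0 j₁≡0 ((_ , rp≤i₂) , (_ , cp≤j₂)) (rq≤rp , cq≤cp) =
  (toℕ≡0⇒≤ i₁≡0 , ≤-trans rq≤rp rp≤i₂) , (toℕ≡0⇒≤ j₁≡0 , ≤-trans cq≤cp cp≤j₂)

RmqOfOwnRegion : ∀ {m n σ} → Array m n σ → Pos m n → Set
RmqOfOwnRegion A p =
  (∀ q → Dominates p q → A at p ≤ A at q)
  × (∀ q → Dominates p q → A at q ≡ A at p → TopLeftOf p q)

InP⇒RmqOfOwnRegion : ∀ {m n σ} {A : Array m n σ} {p} → InP A p → RmqOfOwnRegion A p
InP⇒RmqOfOwnRegion {p = p} (i₂ , j₂ , i₁ , j₁ , i₁≡0 , j₁≡0 , p∈rect , minimal , topLeft) =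
  (λ q p≥q → minimal q (in-rect p≥q)) , (λ q p≥q → topLeft q (in-rect p≥q))
  where
  in-rect : ∀ {q} → Dominates p q → InRect i₁ i₂ j₁ j₂ q
  in-rect = origin-rect-⊇-dominated i₁≡0 j₁≡0 p∈rect

module _ {m n σ} (A : Array m n σ) (ℓ : Fin σ) where

  InS-antichain : Antichain (InS A ℓ)
  InS-antichain p q (_ , p≡ℓ) (q∈P , q≡ℓ) p≢q q≥p =
    p≢q (sym (dominating-topLeftOf⇒≡ q≥p q-topLeftOf-p))
    where
    q-topLeftOf-p : TopLeftOf q p
    q-topLeftOf-p = proj₂ (InP⇒RmqOfOwnRegion q∈P) p q≥p (trans p≡ℓ (sym q≡ℓ))

  InS-region-≥ : ∀ p q → InS A ℓ p → row q ≤ row p → col q ≤ col p → ℓ ≤ A at q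
  InS-region-≥ p q (p∈P , p≡ℓ) rq≤rp cq≤cp =
    subst (_≤ A at q) p≡ℓ (proj₁ (InP⇒RmqOfOwnRegion p∈P) q (rq≤rp , cq≤cp))

proposition9 : ∀ {m n σ : ℕ} (A : Array m n σ) (ℓ : Fin σ) →
    ((p q : Pos m n) → InS A ℓ p → InS A ℓ q → ¬ (p ≡ q) → ¬ Dominates q p)
    × ((k : ℕ) (p : Pos m n) → KthBottom (InS A ℓ) k p ⇔ KthLeft (InS A ℓ) k p)
    × ((p q : Pos m n) → InS A ℓ p → row q ≤ row p → col q ≤ col p → ℓ ≤ A at q)
proposition9 A ℓ = InS-antichain A ℓ , KthBottom⇔KthLeft (InS-antichain A ℓ) , InS-region-≥ A ℓ
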